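{- Let $d\ge 1$, let $U=\{x\in\mathbb{R}^d : |x|=1\}$, and let $p\in\mathbb{R}^d$ with $|p|\ge 1$. Let $V=\{p+v : |v|\le 1/2\}$ be the closed ball of radius $1/2$ centered at $p$. Let $Q_1$ be the set of points $q\in U$ such that $q$ is visible from some point $r\in V$, and let $Q_2$ be the set of points $q\in U$ visible from the point $2p$. Then $Q_1\subseteq Q_2$.
   Context: $|\cdot|$ denotes the Euclidean norm. A point $p\in\mathbb{R}^d$ with $|p|\ge 1$ views (sees) a point $q\in U$ if the segment $\overline{pq}$ intersects $U$ only at $q$; points $p$ with $|p|<1$ view no point of $U$. Equivalently, for $|p|\ge 1$, $p$ views $q\in U$ iff $\langle p,q\rangle\ge 1$. -}

module Defs where

open import Level using (Level; suc; _⊔_)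
open import Data.Nat using (ℕ; zero) renaming (suc to sucℕ)
open import Data.Fin using (Fin) renaming (zero to fzero; suc to fsuc)
open import Data.Product using (Σ; ∃; _×_)
open import Relation.Binary.PropositionalEquality using (_≡_)
open import Relation.Nullary using (¬_)
open import Algebra.Structures using (IsCommutativeRing)
open import Relation.Binary.Structures using (IsTotalOrder)

-- An axiomatic model of the real numbers: a complete ordered field
-- (all such models are isomorphic to ℝ). The stdlib has no reals.
record RealField (c : Level) : Set (suc c) where
  infixl 6 _+_
  infixl 7 _*_
  infix 4 _≤_
  field
    Carrier : Set c
    _+_ _*_ : Carrier → Carrier → Carrier
    -_ : Carrier → Carrier
    0# 1# : Carrier
    _≤_ : Carrier → Carrier → Set c
    isCommutativeRing : IsCommutativeRing _≡_ _+_ _*_ -_ 0# 1#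
    isTotalOrder : IsTotalOrder _≡_ _≤_
    0≢1 : ¬ (0# ≡ 1#)
    inverse : ∀ x → ¬ (x ≡ 0#) → Σ Carrier (λ y → x * y ≡ 1#)
    +-mono-≤ : ∀ {x y} z → x ≤ y → x + z ≤ y + z
    *-nonneg : ∀ {x y} → 0# ≤ x → 0# ≤ y → 0# ≤ x * y
    complete : (P : Carrier → Set c) → ∃ P →
               Σ Carrier (λ b → ∀ x → P x → x ≤ b) →
               Σ Carrier (λ s → (∀ x → P x → x ≤ s) ×
                                (∀ b → (∀ x → P x → x ≤ b) → s ≤ b))

module Geometry {c : Level} (R : RealField c) where
  open RealField R public

  _-ᵣ_ : Carrier → Carrier → Carrier
  x -ᵣ y = x + (- y)

  2# : Carrier
  2# = 1# + 1#

  4# : Carrier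
  4# = 2# + 2#

  Pt : ℕ → Set c
  Pt d = Fin d → Carrier

  ⟨_,_⟩ : ∀ {d} → Pt d → Pt d → Carrier
  ⟨_,_⟩ {zero} x y = 0#
  ⟨_,_⟩ {sucℕ d} x y = x fzero * y fzero + ⟨ (λ i → x (fsuc i)) , (λ i → y (fsuc i)) ⟩

  ‖_‖² : ∀ {d} → Pt d → Carrier
  ‖ x ‖² = ⟨ x , x ⟩

  _≐_ : ∀ {d} → Pt d → Pt d → Set c
  x ≐ y = ∀ i → x i ≡ y i

  _·_ : ∀ {d} → Carrier → Pt d → Pt d
  (t · x) i = t * x i

  InU : ∀ {d} → Pt d → Set c
  InU x = ‖ x ‖² ≡ 1#

  segPt : ∀ {d} → Pt d → Pt d → Carrier → Pt d
  segPt p q t i = p i + t * (q i -ᵣ p i)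

  Views : ∀ {d} → Pt d → Pt d → Set c
  Views p q = (1# ≤ ‖ p ‖²) ×
              (∀ t → 0# ≤ t → t ≤ 1# → InU (segPt p q t) → segPt p q t ≐ q)

  InV : ∀ {d} → Pt d → Pt d → Set c
  InV {d} p r = Σ (Pt d) (λ v → (4# * ‖ v ‖² ≤ 1#) × (∀ i → r i ≡ p i + v i))

  InQ₁ : ∀ {d} → Pt d → Pt d → Set c
  InQ₁ {d} p q = InU q × Σ (Pt d) (λ r → InV p r × Views r q)

  InQ₂ : ∀ {d} → Pt d → Pt d → Set c
  InQ₂ p q = InU q × Views (2# · p) q

-- For |q| = 1 and |r| ≥ 1, the point r views q exactly when ⟨r,q⟩ ≥ 1. If ⟨r,q⟩ ≥ 1, a point u of
-- the segment [r,q] lying on U satisfies |u - q|² = 2 (1 - t) (1 - ⟨r,q⟩) ≤ 0, so u = q. If ⟨r,q⟩ < 1,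
-- the segment meets U a second time, at t = (|r|² - 1) / |r - q|². Now let r = p + v with |v| ≤ 1/2
-- view q. Expanding |2v - q|² ≥ 0 gives ⟨v,q⟩ ≤ 1/2, hence ⟨2p,q⟩ = 2 (⟨r,q⟩ - ⟨v,q⟩) ≥ 1, and 2p
-- views q.
module Submission where

open import Defs
open import Level using (Level)
open import Data.Nat.Base as ℕ using (ℕ; zero; suc) renaming (_≤_ to _≤ℕ_)
import Data.Nat.Properties as ℕ
import Data.Integer.Base as ℤ
open ℤ using (0ℤ; 1ℤ)
import Data.Integer.Properties as ℤP
import Data.Sign.Base as Sign
open import Data.Fin.Base using () renaming (zero to fzero; suc to fsuc)
open import Data.Vec.Functional using (head; tail)
open import Data.Maybe.Base using (map)
open import Data.Product.Base using (Σ; _×_; _,_; proj₁; proj₂)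
open import Data.Sum.Base using (inj₁; inj₂)
open import Data.Empty using (⊥-elim)
open import Function.Base using (_∘_)
open import Relation.Nullary.Negation using (¬_)
open import Relation.Binary.Structures using (IsTotalOrder)
open import Relation.Binary.Consequences using (dec⇒weaklyDec)
import Relation.Binary.PropositionalEquality as ≡
open ≡ using (_≡_)
open import Algebra.Bundles using (CommutativeRing)

-- The ring solver needs coefficients with decidable equality, which a general carrier lacks;
-- ℤ maps into every commutative ring.
module IntegerCoefficients {c ℓ} (CR : CommutativeRing c ℓ) where
  open ℤ using (+_; -[1+_]; _⊖_)
  open CommutativeRing CR
  open import Algebra.Properties.Ring ring using (-‿distribˡ-*; -‿distribʳ-*)
  open import Algebra.Properties.Group +-group using (ε⁻¹≈ε; ⁻¹-involutive)
  open import Algebra.Properties.AbelianGroup +-abelianGroup using (⁻¹-∙-comm; xyx⁻¹≈y)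
  open import Algebra.Properties.Semiring.Mult.TCOptimised semiring using (1+×; ×-homo-+; ×1-homo-*)
    renaming (_×_ to _×ₙ_)
  open import Algebra.Solver.Ring.AlmostCommutativeRing using (fromCommutativeRing; _-Raw-AlmostCommutative⟶_)
  open import Relation.Binary.Reasoning.Setoid setoid

  private
    fromℤ : ℤ.ℤ → Carrier
    fromℤ (+ n) = n ×ₙ 1#
    fromℤ (-[1+ n ]) = - (suc n ×ₙ 1#)

    ⊖-homo : ∀ m n → fromℤ (m ⊖ n) ≈ m ×ₙ 1# - n ×ₙ 1#
    ⊖-homo m zero = begin
      m ×ₙ 1#       ≈⟨ +-identityʳ _ ⟨
      m ×ₙ 1# + 0#  ≈⟨ +-congˡ ε⁻¹≈ε ⟨
      m ×ₙ 1# - 0#  ∎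
    ⊖-homo zero (suc n) = sym (+-identityˡ _)
    ⊖-homo (suc m) (suc n) = begin
      fromℤ (suc m ⊖ suc n)            ≡⟨ ≡.cong fromℤ (ℤP.[1+m]⊖[1+n]≡m⊖n m n) ⟩
      fromℤ (m ⊖ n)                    ≈⟨ ⊖-homo m n ⟩
      m ×ₙ 1# - n ×ₙ 1#                ≈⟨ +-congʳ (xyx⁻¹≈y 1# (m ×ₙ 1#)) ⟨
      1# + m ×ₙ 1# - 1# - n ×ₙ 1#      ≈⟨ +-assoc _ _ _ ⟩
      1# + m ×ₙ 1# + (- 1# - n ×ₙ 1#)  ≈⟨ +-congˡ (⁻¹-∙-comm 1# (n ×ₙ 1#)) ⟩
      1# + m ×ₙ 1# - (1# + n ×ₙ 1#)    ≈⟨ +-cong (1+× m 1#) (-‿cong (1+× n 1#)) ⟨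
      suc m ×ₙ 1# - suc n ×ₙ 1#        ∎

    +-homo : ∀ i j → fromℤ (i ℤ.+ j) ≈ fromℤ i + fromℤ j
    +-homo (+ m) (+ n) = ×-homo-+ 1# m n
    +-homo (+ m) -[1+ n ] = ⊖-homo m (suc n)
    +-homo -[1+ m ] (+ n) = trans (⊖-homo n (suc m)) (+-comm _ _)
    +-homo -[1+ m ] -[1+ n ] = begin
      - (suc (suc (m ℕ.+ n)) ×ₙ 1#)  ≡⟨ ≡.cong (λ k → - (suc k ×ₙ 1#)) (ℕ.+-suc m n) ⟨
      - ((suc m ℕ.+ suc n) ×ₙ 1#)    ≈⟨ -‿cong (×-homo-+ 1# (suc m) (suc n)) ⟩
      - (suc m ×ₙ 1# + suc n ×ₙ 1#)  ≈⟨ ⁻¹-∙-comm _ _ ⟨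
      - (suc m ×ₙ 1#) - suc n ×ₙ 1#  ∎

    +◃-homo : ∀ n → fromℤ (Sign.+ ℤ.◃ n) ≈ n ×ₙ 1#
    +◃-homo zero = refl
    +◃-homo (suc n) = refl

    -◃-homo : ∀ n → fromℤ (Sign.- ℤ.◃ n) ≈ - (n ×ₙ 1#)
    -◃-homo zero = sym ε⁻¹≈ε
    -◃-homo (suc n) = refl

    *-homo : ∀ i j → fromℤ (i ℤ.* j) ≈ fromℤ i * fromℤ j
    *-homo (+ m) (+ n) = trans (+◃-homo (m ℕ.* n)) (×1-homo-* m n)
    *-homo (+ m) -[1+ n ] = begin
      fromℤ (Sign.- ℤ.◃ m ℕ.* suc n)  ≈⟨ -◃-homo (m ℕ.* suc n) ⟩
      - ((m ℕ.* suc n) ×ₙ 1#)         ≈⟨ -‿cong (×1-homo-* m (suc n)) ⟩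
      - (m ×ₙ 1# * suc n ×ₙ 1#)       ≈⟨ -‿distribʳ-* _ _ ⟩
      m ×ₙ 1# * - (suc n ×ₙ 1#)       ∎
    *-homo -[1+ m ] (+ n) = begin
      fromℤ (Sign.- ℤ.◃ suc m ℕ.* n)  ≈⟨ -◃-homo (suc m ℕ.* n) ⟩
      - ((suc m ℕ.* n) ×ₙ 1#)         ≈⟨ -‿cong (×1-homo-* (suc m) n) ⟩
      - (suc m ×ₙ 1# * n ×ₙ 1#)       ≈⟨ -‿distribˡ-* _ _ ⟩
      - (suc m ×ₙ 1#) * n ×ₙ 1#       ∎
    *-homo -[1+ m ] -[1+ n ] = begin
      fromℤ (Sign.+ ℤ.◃ suc m ℕ.* suc n)  ≈⟨ +◃-homo (suc m ℕ.* suc n) ⟩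
      (suc m ℕ.* suc n) ×ₙ 1#             ≈⟨ ×1-homo-* (suc m) (suc n) ⟩
      suc m ×ₙ 1# * suc n ×ₙ 1#           ≈⟨ ⁻¹-involutive _ ⟨
      - - (suc m ×ₙ 1# * suc n ×ₙ 1#)     ≈⟨ -‿cong (-‿distribˡ-* _ _) ⟩
      - (- (suc m ×ₙ 1#) * suc n ×ₙ 1#)   ≈⟨ -‿distribʳ-* _ _ ⟩
      - (suc m ×ₙ 1#) * - (suc n ×ₙ 1#)   ∎

    -‿homo : ∀ i → fromℤ (ℤ.- i) ≈ - fromℤ i
    -‿homo (+ zero) = sym ε⁻¹≈ε
    -‿homo (+ suc n) = refl
    -‿homo -[1+ n ] = sym (⁻¹-involutive _)

    homomorphism : ℤ.+-*-rawRing -Raw-AlmostCommutative⟶ fromCommutativeRing CR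
    homomorphism = record
      { ⟦_⟧ = fromℤ ; +-homo = +-homo ; *-homo = *-homo ; -‿homo = -‿homo
      ; 0-homo = refl ; 1-homo = refl }

  open import Algebra.Solver.Ring ℤ.+-*-rawRing (fromCommutativeRing CR) homomorphism
    (λ i j → map (reflexive ∘ ≡.cong fromℤ) (dec⇒weaklyDec ℤP._≟_ i j))
    public using (solve; _:=_; con; _:+_; _:-_; _:*_)

module _ {c : Level} (R : RealField c) where
  open Geometry R
  open ≡ using (refl; sym; trans; cong; cong₂; subst; subst₂)
  open ≡.≡-Reasoning
  open IsTotalOrder isTotalOrder using (total; antisym)
    renaming (refl to ≤-refl; trans to ≤-trans; reflexive to ≤-reflexive)

  commutativeRing : CommutativeRing c c
  commutativeRing = record { isCommutativeRing = isCommutativeRing }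

  open CommutativeRing commutativeRing
    using (+-identityˡ; +-comm; *-comm; *-identityˡ; *-identityʳ; zeroˡ; zeroʳ; -‿inverseʳ; +-rawMonoid)
  open IntegerCoefficients commutativeRing
  open import Algebra.Definitions.RawMonoid +-rawMonoid using () renaming (_×_ to _×ₙ_)

  -- Defs gives _-ᵣ_ no fixity, so it binds tighter than _*_ and _+_: x -ᵣ (t * y) needs its parentheses.

  x≤y⇒0≤y-x : ∀ {x y} → x ≤ y → 0# ≤ y -ᵣ x
  x≤y⇒0≤y-x {x} {y} x≤y = subst (_≤ y -ᵣ x) (-‿inverseʳ x) (+-mono-≤ (- x) x≤y)

  0≤y-x⇒x≤y : ∀ {x y} → 0# ≤ y -ᵣ x → x ≤ y
  0≤y-x⇒x≤y {x} {y} 0≤y-x = subst₂ _≤_ (+-identityˡ x)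
    (solve 2 (λ x y → y :- x :+ x := y) refl x y) (+-mono-≤ x 0≤y-x)

  x-y≤0⇒x≤y : ∀ {x y} → x -ᵣ y ≤ 0# → x ≤ y
  x-y≤0⇒x≤y {x} {y} x-y≤0 = subst₂ _≤_
    (solve 2 (λ x y → x :- y :+ y := x) refl x y) (+-identityˡ y) (+-mono-≤ y x-y≤0)

  ≰⇒≥ : ∀ {x y} → ¬ x ≤ y → y ≤ x
  ≰⇒≥ {x} {y} x≰y with total x y
  ... | inj₁ x≤y = ⊥-elim (x≰y x≤y)
  ... | inj₂ y≤x = y≤x

  x≤y+x : ∀ {x y} → 0# ≤ y → x ≤ y + x
  x≤y+x {x} {y} 0≤y = subst (_≤ y + x) (+-identityˡ x) (+-mono-≤ x 0≤y)

  x≤x+y : ∀ {x y} → 0# ≤ y → x ≤ x + y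
  x≤x+y {x} {y} 0≤y = subst (x ≤_) (+-comm y x) (x≤y+x 0≤y)

  +-nonneg : ∀ {x y} → 0# ≤ x → 0# ≤ y → 0# ≤ x + y
  +-nonneg 0≤x 0≤y = ≤-trans 0≤x (x≤x+y 0≤y)

  x*x-nonneg : ∀ x → 0# ≤ x * x
  x*x-nonneg x with total 0# x
  ... | inj₁ 0≤x = *-nonneg 0≤x 0≤x
  ... | inj₂ x≤0 = subst (0# ≤_) (solve 1 (λ x → (con 0ℤ :- x) :* (con 0ℤ :- x) := x :* x) refl x)
                     (*-nonneg (x≤y⇒0≤y-x x≤0) (x≤y⇒0≤y-x x≤0))

  0≤1 : 0# ≤ 1#
  0≤1 = subst (0# ≤_) (*-identityˡ 1#) (x*x-nonneg 1#)

  1≰0 : ¬ 1# ≤ 0#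
  1≰0 1≤0 = 0≢1 (antisym 0≤1 1≤0)

  *-nonneg-nonpos : ∀ {x y} → 0# ≤ x → y ≤ 0# → x * y ≤ 0#
  *-nonneg-nonpos {x} {y} 0≤x y≤0 = 0≤y-x⇒x≤y (subst (0# ≤_)
    (solve 2 (λ x y → x :* (con 0ℤ :- y) := con 0ℤ :- x :* y) refl x y)
    (*-nonneg 0≤x (x≤y⇒0≤y-x y≤0)))

  x+x-nonneg⇒nonneg : ∀ {x} → 0# ≤ x + x → 0# ≤ x
  x+x-nonneg⇒nonneg {x} 0≤x+x with total 0# x
  ... | inj₁ 0≤x = 0≤x
  ... | inj₂ x≤0 = ≤-trans 0≤x+x (subst (x + x ≤_) (+-identityˡ x) (+-mono-≤ x x≤0))

  x+x-nonpos⇒≡0 : ∀ {x} → 0# ≤ x → x + x ≤ 0# → x ≡ 0#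
  x+x-nonpos⇒≡0 0≤x x+x≤0 = antisym (≤-trans (x≤x+y 0≤x) x+x≤0) 0≤x

  inverse-nonneg : ∀ {x y} → 0# ≤ x → x * y ≡ 1# → 0# ≤ y
  inverse-nonneg {y = y} 0≤x xy≡1 with total 0# y
  ... | inj₁ 0≤y = 0≤y
  ... | inj₂ y≤0 = ⊥-elim (1≰0 (subst (_≤ 0#) xy≡1 (*-nonneg-nonpos 0≤x y≤0)))

  *-cancelˡ-zero : ∀ {x y} → ¬ x ≡ 0# → x * y ≡ 0# → y ≡ 0#
  *-cancelˡ-zero {x} {y} x≢0 xy≡0 with inverse x x≢0
  ... | x⁻¹ , xx⁻¹≡1 = begin
    y                 ≡⟨ *-identityˡ y ⟨
    1# * y            ≡⟨ cong (_* y) xx⁻¹≡1 ⟨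
    x * x⁻¹ * y       ≡⟨ solve 3 (λ x x⁻¹ y → x :* x⁻¹ :* y := x⁻¹ :* (x :* y)) refl x x⁻¹ y ⟩
    x⁻¹ * (x * y)     ≡⟨ cong (x⁻¹ *_) xy≡0 ⟩
    x⁻¹ * 0#          ≡⟨ zeroʳ x⁻¹ ⟩
    0#                ∎

  ratio-∈[0,1] : ∀ {a b} → 0# ≤ a → 0# ≤ b → ¬ b ≡ 0# →
                 Σ Carrier λ t → 0# ≤ t × t ≤ 1# × t * (a + b) ≡ a
  ratio-∈[0,1] {a} {b} 0≤a 0≤b b≢0 = a * m⁻¹ , *-nonneg 0≤a 0≤m⁻¹ , a*m⁻¹≤1 , a*m⁻¹*m≡a
    where
    m = a + b
    m≢0 : ¬ m ≡ 0#
    m≢0 m≡0 = b≢0 (antisym (≤-trans (x≤y+x 0≤a) (≤-reflexive m≡0)) 0≤b)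
    m⁻¹ = proj₁ (inverse m m≢0)
    mm⁻¹≡1 : m * m⁻¹ ≡ 1#
    mm⁻¹≡1 = proj₂ (inverse m m≢0)
    0≤m⁻¹ : 0# ≤ m⁻¹
    0≤m⁻¹ = inverse-nonneg (+-nonneg 0≤a 0≤b) mm⁻¹≡1
    a*m⁻¹≤1 : a * m⁻¹ ≤ 1#
    a*m⁻¹≤1 = 0≤y-x⇒x≤y (subst (λ z → 0# ≤ z -ᵣ (a * m⁻¹)) mm⁻¹≡1
      (subst (0# ≤_) (solve 3 (λ a b i → b :* i := (a :+ b) :* i :- a :* i) refl a b m⁻¹)
        (*-nonneg 0≤b 0≤m⁻¹)))
    a*m⁻¹*m≡a : a * m⁻¹ * m ≡ a
    a*m⁻¹*m≡a = begin
      a * m⁻¹ * m   ≡⟨ solve 3 (λ a i m → a :* i :* m := a :* (m :* i)) refl a m⁻¹ m ⟩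
      a * (m * m⁻¹) ≡⟨ cong (a *_) mm⁻¹≡1 ⟩
      a * 1#        ≡⟨ *-identityʳ a ⟩
      a             ∎

  -- Equality on the carrier is not decidable. The Archimedean property, a consequence of
  -- completeness, makes _≡_ and _≤_ stable under double negation instead, which is what
  -- allows the proof of views⇒1≤⟨⟩ by contradiction.

  ×-zeroʳ : ∀ n → n ×ₙ 0# ≡ 0#
  ×-zeroʳ zero = refl
  ×-zeroʳ (suc n) = trans (+-identityˡ (n ×ₙ 0#)) (×-zeroʳ n)

  archimedean : ∀ {y} → (∀ n → n ×ₙ y ≤ 1#) → y ≤ 0#
  archimedean {y} n×y≤1 =
    let (s , s-upper , s-least) = complete multiple (0# , 0 , refl) (1# , λ { _ (n , refl) → n×y≤1 n })
        s≤s-y : s ≤ s -ᵣ y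
        s≤s-y = s-least (s -ᵣ y) λ { _ (n , refl) →
          subst (_≤ s -ᵣ y) (solve 2 (λ y w → y :+ w :- y := w) refl y (n ×ₙ y))
            (+-mono-≤ (- y) (s-upper (suc n ×ₙ y) (suc n , refl))) }
    in subst₂ _≤_ (solve 2 (λ s y → s :+ (y :- s) := y) refl s y)
                  (solve 2 (λ s y → s :- y :+ (y :- s) := con 0ℤ) refl s y)
                  (+-mono-≤ (y -ᵣ s) s≤s-y)
    where
    multiple : Carrier → Set c
    multiple w = Σ ℕ (λ n → w ≡ n ×ₙ y)

  ¬¬≡⇒≥ : ∀ {x y} → ¬ ¬ x ≡ y → y ≤ x
  ¬¬≡⇒≥ {x} {y} ¬¬x≡y = x-y≤0⇒x≤y (archimedean n×[y-x]≤1)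
    where
    n×[y-x]≤1 : ∀ n → n ×ₙ (y -ᵣ x) ≤ 1#
    n×[y-x]≤1 n with total (n ×ₙ (y -ᵣ x)) 1#
    ... | inj₁ ≤1 = ≤1
    ... | inj₂ 1≤ = ⊥-elim (¬¬x≡y λ { refl → 1≰0 (subst (1# ≤_) (×-zeroʳ n)
                                                  (subst (λ z → 1# ≤ n ×ₙ z) (-‿inverseʳ x) 1≤)) })

  ≡-stable : ∀ {x y} → ¬ ¬ x ≡ y → x ≡ y
  ≡-stable ¬¬x≡y = antisym (¬¬≡⇒≥ (λ y≢x → ¬¬x≡y (y≢x ∘ sym))) (¬¬≡⇒≥ ¬¬x≡y)

  ≤-stable : ∀ {x y} → ¬ ¬ x ≤ y → x ≤ y
  ≤-stable {x} {y} ¬¬x≤y with total x y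
  ... | inj₁ x≤y = x≤y
  ... | inj₂ y≤x = ≤-reflexive (≡-stable λ x≢y → ¬¬x≤y (λ x≤y → x≢y (antisym x≤y y≤x)))

  x*x≤0⇒x≡0 : ∀ {x} → x * x ≤ 0# → x ≡ 0#
  x*x≤0⇒x≡0 {x} x*x≤0 = ≡-stable λ x≢0 → x≢0 (*-cancelˡ-zero x≢0 (antisym x*x≤0 (x*x-nonneg x)))

  infixl 6 _+ᵥ_ _-ᵥ_

  _+ᵥ_ _-ᵥ_ : ∀ {d} → Pt d → Pt d → Pt d
  (x +ᵥ y) i = x i + y i
  (x -ᵥ y) i = x i -ᵣ y i

  ⟨⟩-comm : ∀ {d} (x y : Pt d) → ⟨ x , y ⟩ ≡ ⟨ y , x ⟩
  ⟨⟩-comm {zero} x y = refl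
  ⟨⟩-comm {suc d} x y = cong₂ _+_ (*-comm (head x) (head y)) (⟨⟩-comm (tail x) (tail y))

  ⟨⟩-congˡ : ∀ {d} {x x′ : Pt d} → x ≐ x′ → ∀ z → ⟨ x , z ⟩ ≡ ⟨ x′ , z ⟩
  ⟨⟩-congˡ {zero} x≐x′ z = refl
  ⟨⟩-congˡ {suc d} x≐x′ z = cong₂ _+_ (cong (_* head z) (x≐x′ fzero)) (⟨⟩-congˡ (x≐x′ ∘ fsuc) (tail z))

  ⟨+ᵥ⟩ˡ : ∀ {d} (x y z : Pt d) → ⟨ x +ᵥ y , z ⟩ ≡ ⟨ x , z ⟩ + ⟨ y , z ⟩
  ⟨+ᵥ⟩ˡ {zero} x y z = sym (+-identityˡ 0#)
  ⟨+ᵥ⟩ˡ {suc d} x y z = trans (cong₂ _+_ refl (⟨+ᵥ⟩ˡ (tail x) (tail y) (tail z)))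
    (solve 5 (λ a b c s t → (a :+ b) :* c :+ (s :+ t) := (a :* c :+ s) :+ (b :* c :+ t)) refl
      (head x) (head y) (head z) ⟨ tail x , tail z ⟩ ⟨ tail y , tail z ⟩)

  ⟨-ᵥ⟩ˡ : ∀ {d} (x y z : Pt d) → ⟨ x -ᵥ y , z ⟩ ≡ ⟨ x , z ⟩ -ᵣ ⟨ y , z ⟩
  ⟨-ᵥ⟩ˡ {zero} x y z = sym (-‿inverseʳ 0#)
  ⟨-ᵥ⟩ˡ {suc d} x y z = trans (cong₂ _+_ refl (⟨-ᵥ⟩ˡ (tail x) (tail y) (tail z)))
    (solve 5 (λ a b c s t → (a :- b) :* c :+ (s :- t) := (a :* c :+ s) :- (b :* c :+ t)) refl
      (head x) (head y) (head z) ⟨ tail x , tail z ⟩ ⟨ tail y , tail z ⟩)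

  ⟨·⟩ˡ : ∀ {d} k (x y : Pt d) → ⟨ k · x , y ⟩ ≡ k * ⟨ x , y ⟩
  ⟨·⟩ˡ {zero} k x y = sym (zeroʳ k)
  ⟨·⟩ˡ {suc d} k x y = trans (cong₂ _+_ refl (⟨·⟩ˡ k (tail x) (tail y)))
    (solve 4 (λ k a b s → k :* a :* b :+ k :* s := k :* (a :* b :+ s)) refl
      k (head x) (head y) ⟨ tail x , tail y ⟩)

  ‖·‖² : ∀ {d} k (x : Pt d) → ‖ k · x ‖² ≡ k * (k * ‖ x ‖²)
  ‖·‖² k x = begin
    ⟨ k · x , k · x ⟩       ≡⟨ ⟨·⟩ˡ k x (k · x) ⟩
    k * ⟨ x , k · x ⟩       ≡⟨ cong (k *_) (⟨⟩-comm x (k · x)) ⟩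
    k * ⟨ k · x , x ⟩       ≡⟨ cong (k *_) (⟨·⟩ˡ k x x) ⟩
    k * (k * ‖ x ‖²)        ∎

  ‖‖²-nonneg : ∀ {d} (x : Pt d) → 0# ≤ ‖ x ‖²
  ‖‖²-nonneg {zero} x = ≤-refl
  ‖‖²-nonneg {suc d} x = +-nonneg (x*x-nonneg (head x)) (‖‖²-nonneg (tail x))

  ‖‖²≤0⇒≐0 : ∀ {d} {x : Pt d} → ‖ x ‖² ≤ 0# → ∀ i → x i ≡ 0#
  ‖‖²≤0⇒≐0 {suc d} {x} ‖x‖²≤0 fzero =
    x*x≤0⇒x≡0 (≤-trans (x≤x+y (‖‖²-nonneg (tail x))) ‖x‖²≤0)
  ‖‖²≤0⇒≐0 {suc d} {x} ‖x‖²≤0 (fsuc i) =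
    ‖‖²≤0⇒≐0 (≤-trans (x≤y+x (x*x-nonneg (head x))) ‖x‖²≤0) i

  ‖-ᵥ‖² : ∀ {d} (x y : Pt d) → ‖ x -ᵥ y ‖² ≡ ‖ x ‖² -ᵣ (⟨ x , y ⟩ + ⟨ x , y ⟩) + ‖ y ‖²
  ‖-ᵥ‖² x y = begin
    ⟨ x -ᵥ y , x -ᵥ y ⟩                             ≡⟨ ⟨-ᵥ⟩ˡ x y (x -ᵥ y) ⟩
    ⟨ x , x -ᵥ y ⟩ -ᵣ ⟨ y , x -ᵥ y ⟩                ≡⟨ cong₂ _-ᵣ_ (⟨⟩-comm x _) (⟨⟩-comm y _) ⟩
    ⟨ x -ᵥ y , x ⟩ -ᵣ ⟨ x -ᵥ y , y ⟩                ≡⟨ cong₂ _-ᵣ_ (⟨-ᵥ⟩ˡ x y x) (⟨-ᵥ⟩ˡ x y y) ⟩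
    (‖ x ‖² -ᵣ ⟨ y , x ⟩) -ᵣ (⟨ x , y ⟩ -ᵣ ‖ y ‖²) ≡⟨ cong (λ z → (‖ x ‖² -ᵣ z) -ᵣ (⟨ x , y ⟩ -ᵣ ‖ y ‖²))
                                                             (⟨⟩-comm y x) ⟩
    (‖ x ‖² -ᵣ ⟨ x , y ⟩) -ᵣ (⟨ x , y ⟩ -ᵣ ‖ y ‖²) ≡⟨ solve 3 (λ a b c → a :- b :- (b :- c) := a :- (b :+ b) :+ c)
                                                             refl _ _ _ ⟩
    ‖ x ‖² -ᵣ (⟨ x , y ⟩ + ⟨ x , y ⟩) + ‖ y ‖²      ∎

  ‖-ᵥ‖²≤0⇒≐ : ∀ {d} {x y : Pt d} → ‖ x -ᵥ y ‖² ≤ 0# → x ≐ y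
  ‖-ᵥ‖²≤0⇒≐ {x = x} {y} ‖x-y‖²≤0 i = begin
    x i                  ≡⟨ solve 2 (λ a b → a := a :- b :+ b) refl (x i) (y i) ⟩
    (x i -ᵣ y i) + y i   ≡⟨ cong (_+ y i) (‖‖²≤0⇒≐0 ‖x-y‖²≤0 i) ⟩
    0# + y i             ≡⟨ +-identityˡ (y i) ⟩
    y i                  ∎

  ⟨segPt⟩ˡ : ∀ {d} (p q z : Pt d) t → ⟨ segPt p q t , z ⟩ ≡ ⟨ p , z ⟩ + t * (⟨ q , z ⟩ -ᵣ ⟨ p , z ⟩)
  ⟨segPt⟩ˡ p q z t = begin
    ⟨ p +ᵥ t · (q -ᵥ p) , z ⟩                ≡⟨ ⟨+ᵥ⟩ˡ p _ z ⟩
    ⟨ p , z ⟩ + ⟨ t · (q -ᵥ p) , z ⟩         ≡⟨ cong (⟨ p , z ⟩ +_) (⟨·⟩ˡ t _ z) ⟩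
    ⟨ p , z ⟩ + t * ⟨ q -ᵥ p , z ⟩           ≡⟨ cong (λ w → ⟨ p , z ⟩ + t * w) (⟨-ᵥ⟩ˡ q p z) ⟩
    ⟨ p , z ⟩ + t * (⟨ q , z ⟩ -ᵣ ⟨ p , z ⟩) ∎

  ‖segPt‖² : ∀ {d} (p q : Pt d) t → ‖ segPt p q t ‖² ≡
             ‖ p ‖² + (t + t) * (⟨ p , q ⟩ -ᵣ ‖ p ‖²) + t * t * (‖ q ‖² -ᵣ (⟨ p , q ⟩ + ⟨ p , q ⟩) + ‖ p ‖²)
  ‖segPt‖² p q t = begin
    ⟨ u , u ⟩                                 ≡⟨ ⟨segPt⟩ˡ p q u t ⟩
    ⟨ p , u ⟩ + t * (⟨ q , u ⟩ -ᵣ ⟨ p , u ⟩)  ≡⟨ cong₂ (λ a b → a + t * (b -ᵣ a)) (⟨⟩-comm p u) (⟨⟩-comm q u) ⟩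
    ⟨ u , p ⟩ + t * (⟨ u , q ⟩ -ᵣ ⟨ u , p ⟩)  ≡⟨ cong₂ (λ a b → a + t * (b -ᵣ a)) (⟨segPt⟩ˡ p q p t) (⟨segPt⟩ˡ p q q t) ⟩
    (N + t * (⟨ q , p ⟩ -ᵣ N)) + t * ((s + t * (Q -ᵣ s)) -ᵣ (N + t * (⟨ q , p ⟩ -ᵣ N)))
      ≡⟨ cong (λ s′ → (N + t * (s′ -ᵣ N)) + t * ((s + t * (Q -ᵣ s)) -ᵣ (N + t * (s′ -ᵣ N)))) (⟨⟩-comm q p) ⟩
    (N + t * (s -ᵣ N)) + t * ((s + t * (Q -ᵣ s)) -ᵣ (N + t * (s -ᵣ N)))
      ≡⟨ solve 4 (λ N s Q t → (N :+ t :* (s :- N)) :+ t :* ((s :+ t :* (Q :- s)) :- (N :+ t :* (s :- N)))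
                          := N :+ (t :+ t) :* (s :- N) :+ t :* t :* (Q :- (s :+ s) :+ N)) refl N s Q t ⟩
    N + (t + t) * (s -ᵣ N) + t * t * (Q -ᵣ (s + s) + N)
      ∎
    where
    u = segPt p q t
    N = ‖ p ‖²
    s = ⟨ p , q ⟩
    Q = ‖ q ‖²

  ⟨segPt,q⟩ : ∀ {d} {q : Pt d} → InU q → ∀ r t → ⟨ segPt r q t , q ⟩ ≡ ⟨ r , q ⟩ + t * (1# -ᵣ ⟨ r , q ⟩)
  ⟨segPt,q⟩ {q = q} q∈U r t = trans (⟨segPt⟩ˡ r q q t) (cong (λ Q → ⟨ r , q ⟩ + t * (Q -ᵣ ⟨ r , q ⟩)) q∈U)

  -- With C = |r|² - 1 and y = 1 - ⟨r,q⟩ > 0, the point at t = C / (C + 2y) lies on U; it is not q,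
  -- since ⟨u,q⟩ = 1 - (1 - t) y would force t = 1, i.e. y = 0.
  segPt-reenters-U : ∀ {d} {r q : Pt d} → InU q → 1# ≤ ‖ r ‖² → ⟨ r , q ⟩ ≤ 1# → ¬ ⟨ r , q ⟩ ≡ 1# →
                     Σ Carrier λ t → 0# ≤ t × t ≤ 1# × InU (segPt r q t) × ¬ segPt r q t ≐ q
  segPt-reenters-U {r = r} {q} q∈U 1≤N s≤1 s≢1 =
    let (t , 0≤t , t≤1 , t*A≡C) = ratio-∈[0,1] (x≤y⇒0≤y-x 1≤N) (+-nonneg 0≤y 0≤y) y+y≢0
    in t , 0≤t , t≤1 , segPt∈U t t*A≡C , segPt≢q t t*A≡C
    where
    N = ‖ r ‖²
    s = ⟨ r , q ⟩
    y = 1# -ᵣ s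
    C = N -ᵣ 1#
    A = C + (y + y)
    0≤y : 0# ≤ y
    0≤y = x≤y⇒0≤y-x s≤1
    y≢0 : ¬ y ≡ 0#
    y≢0 y≡0 = s≢1 (begin
      s          ≡⟨ solve 1 (λ s → s := con 1ℤ :- (con 1ℤ :- s)) refl s ⟩
      1# -ᵣ y    ≡⟨ cong (1# -ᵣ_) y≡0 ⟩
      1# -ᵣ 0#   ≡⟨ solve 0 (con 1ℤ :- con 0ℤ := con 1ℤ) refl ⟩
      1#         ∎)
    y+y≢0 : ¬ y + y ≡ 0#
    y+y≢0 y+y≡0 = y≢0 (x+x-nonpos⇒≡0 0≤y (≤-reflexive y+y≡0))

    segPt∈U : ∀ t → t * A ≡ C → InU (segPt r q t)
    segPt∈U t t*A≡C = begin
      ‖ segPt r q t ‖²                                          ≡⟨ ‖segPt‖² r q t ⟩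
      N + (t + t) * (s -ᵣ N) + t * t * (‖ q ‖² -ᵣ (s + s) + N)
        ≡⟨ cong (λ Q → N + (t + t) * (s -ᵣ N) + t * t * (Q -ᵣ (s + s) + N)) q∈U ⟩
      N + (t + t) * (s -ᵣ N) + t * t * (1# -ᵣ (s + s) + N)
        ≡⟨ solve 3 (λ N s t → N :+ (t :+ t) :* (s :- N) :+ t :* t :* (con 1ℤ :- (s :+ s) :+ N)
                            := con 1ℤ :+ (con 1ℤ :- t) :* ((N :- con 1ℤ)
                                 :- t :* ((N :- con 1ℤ) :+ ((con 1ℤ :- s) :+ (con 1ℤ :- s))))) refl N s t ⟩
      1# + (1# -ᵣ t) * (C -ᵣ (t * A))                           ≡⟨ cong (λ z → 1# + (1# -ᵣ t) * (C -ᵣ z)) t*A≡C ⟩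
      1# + (1# -ᵣ t) * (C -ᵣ C)                                 ≡⟨ solve 2 (λ t C → con 1ℤ :+ (con 1ℤ :- t) :* (C :- C)
                                                                                  := con 1ℤ) refl t C ⟩
      1#                                                        ∎

    segPt≢q : ∀ t → t * A ≡ C → ¬ segPt r q t ≐ q
    segPt≢q t t*A≡C u≐q = y+y≢0 (begin
      y + y            ≡⟨ solve 2 (λ C y → y :+ y := (C :+ (y :+ y)) :- C) refl C y ⟩
      A -ᵣ C           ≡⟨ cong (A -ᵣ_) t*A≡C ⟨
      A -ᵣ (t * A)     ≡⟨ solve 2 (λ t A → A :- t :* A := (con 1ℤ :- t) :* A) refl t A ⟩
      (1# -ᵣ t) * A    ≡⟨ cong (_* A) 1-t≡0 ⟩
      0# * A           ≡⟨ zeroˡ A ⟩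
      0#               ∎)
      where
      y*[1-t]≡0 : y * (1# -ᵣ t) ≡ 0#
      y*[1-t]≡0 = begin
        y * (1# -ᵣ t)              ≡⟨ solve 2 (λ s t → (con 1ℤ :- s) :* (con 1ℤ :- t)
                                                     := con 1ℤ :- (s :+ t :* (con 1ℤ :- s))) refl s t ⟩
        1# -ᵣ (s + t * (1# -ᵣ s))  ≡⟨ cong (1# -ᵣ_) (⟨segPt,q⟩ q∈U r t) ⟨
        1# -ᵣ ⟨ segPt r q t , q ⟩  ≡⟨ cong (1# -ᵣ_) (trans (⟨⟩-congˡ u≐q q) q∈U) ⟩
        1# -ᵣ 1#                   ≡⟨ -‿inverseʳ 1# ⟩
        0#                         ∎
      1-t≡0 : 1# -ᵣ t ≡ 0#
      1-t≡0 = *-cancelˡ-zero y≢0 y*[1-t]≡0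

  views⇒1≤⟨⟩ : ∀ {d} {r q : Pt d} → InU q → Views r q → 1# ≤ ⟨ r , q ⟩
  views⇒1≤⟨⟩ q∈U (1≤‖r‖² , only-q) = ≤-stable λ 1≰s →
    let (t , 0≤t , t≤1 , u∈U , u≢q) =
          segPt-reenters-U q∈U 1≤‖r‖² (≰⇒≥ 1≰s) (λ s≡1 → 1≰s (≤-reflexive (sym s≡1)))
    in u≢q (only-q t 0≤t t≤1 u∈U)

  1≤⟨⟩⇒views : ∀ {d} {r q : Pt d} → InU q → 1# ≤ ‖ r ‖² → 1# ≤ ⟨ r , q ⟩ → Views r q
  1≤⟨⟩⇒views {r = r} {q} q∈U 1≤‖r‖² 1≤s = 1≤‖r‖² , λ t 0≤t t≤1 u∈U →
    ‖-ᵥ‖²≤0⇒≐ (≤-trans (x≤x+y (+-nonneg (e-nonneg t≤1) (e-nonneg t≤1))) (≤-reflexive (‖u-q‖²+2e≡0 t u∈U)))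
    where
    s = ⟨ r , q ⟩
    e : Carrier → Carrier
    e t = (1# -ᵣ t) * (s -ᵣ 1#)
    e-nonneg : ∀ {t} → t ≤ 1# → 0# ≤ e t
    e-nonneg t≤1 = *-nonneg (x≤y⇒0≤y-x t≤1) (x≤y⇒0≤y-x 1≤s)
    ‖u-q‖²+2e≡0 : ∀ t → InU (segPt r q t) → ‖ segPt r q t -ᵥ q ‖² + (e t + e t) ≡ 0#
    ‖u-q‖²+2e≡0 t u∈U = begin
      ‖ u -ᵥ q ‖² + (e t + e t)
        ≡⟨ cong (_+ (e t + e t)) (‖-ᵥ‖² u q) ⟩
      ‖ u ‖² -ᵣ (⟨ u , q ⟩ + ⟨ u , q ⟩) + ‖ q ‖² + (e t + e t)
        ≡⟨ cong₂ (λ a c → a -ᵣ (⟨ u , q ⟩ + ⟨ u , q ⟩) + c + (e t + e t)) u∈U q∈U ⟩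
      1# -ᵣ (⟨ u , q ⟩ + ⟨ u , q ⟩) + 1# + (e t + e t)
        ≡⟨ cong (λ b → 1# -ᵣ (b + b) + 1# + (e t + e t)) (⟨segPt,q⟩ q∈U r t) ⟩
      1# -ᵣ (w + w) + 1# + (e t + e t)
        ≡⟨ solve 2 (λ s t → con 1ℤ :- ((s :+ t :* (con 1ℤ :- s)) :+ (s :+ t :* (con 1ℤ :- s))) :+ con 1ℤ
                            :+ ((con 1ℤ :- t) :* (s :- con 1ℤ) :+ (con 1ℤ :- t) :* (s :- con 1ℤ))
                            := con 0ℤ) refl s t ⟩
      0#
        ∎
      where
      u = segPt r q t
      w = s + t * (1# -ᵣ s)

  ‖v‖≤½⇒2⟨v,q⟩≤1 : ∀ {d} (v q : Pt d) → 4# * ‖ v ‖² ≤ 1# → InU q → 2# * ⟨ v , q ⟩ ≤ 1#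
  ‖v‖≤½⇒2⟨v,q⟩≤1 v q 4‖v‖²≤1 q∈U = 0≤y-x⇒x≤y (x+x-nonneg⇒nonneg
    (subst (0# ≤_) sum≡ (+-nonneg (‖‖²-nonneg (2# · v -ᵥ q)) (x≤y⇒0≤y-x 4‖v‖²≤1))))
    where
    N = ‖ v ‖²
    b = ⟨ v , q ⟩
    sum≡ : ‖ 2# · v -ᵥ q ‖² + (1# -ᵣ (4# * N)) ≡ (1# -ᵣ (2# * b)) + (1# -ᵣ (2# * b))
    sum≡ = begin
      ‖ 2# · v -ᵥ q ‖² + (1# -ᵣ (4# * N))
        ≡⟨ cong (_+ (1# -ᵣ (4# * N))) (‖-ᵥ‖² (2# · v) q) ⟩
      ‖ 2# · v ‖² -ᵣ (⟨ 2# · v , q ⟩ + ⟨ 2# · v , q ⟩) + ‖ q ‖² + (1# -ᵣ (4# * N))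
        ≡⟨ cong₂ (λ a c → a -ᵣ (⟨ 2# · v , q ⟩ + ⟨ 2# · v , q ⟩) + c + (1# -ᵣ (4# * N))) (‖·‖² 2# v) q∈U ⟩
      (2# * (2# * N)) -ᵣ (⟨ 2# · v , q ⟩ + ⟨ 2# · v , q ⟩) + 1# + (1# -ᵣ (4# * N))
        ≡⟨ cong (λ a → (2# * (2# * N)) -ᵣ (a + a) + 1# + (1# -ᵣ (4# * N))) (⟨·⟩ˡ 2# v q) ⟩
      (2# * (2# * N)) -ᵣ (2# * b + 2# * b) + 1# + (1# -ᵣ (4# * N))
        ≡⟨ solve 2 (λ N b → two :* (two :* N) :- (two :* b :+ two :* b) :+ con 1ℤ :+ (con 1ℤ :- (two :+ two) :* N)
                            := (con 1ℤ :- two :* b) :+ (con 1ℤ :- two :* b)) refl N b ⟩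
      (1# -ᵣ (2# * b)) + (1# -ᵣ (2# * b))
        ∎
      where two = con (ℤ.+ 2)

  Q₁⊆Q₂ : ∀ {d} (p : Pt d) → 1# ≤ ‖ p ‖² → ∀ q → InQ₁ p q → InQ₂ p q
  Q₁⊆Q₂ p 1≤‖p‖² q (q∈U , r , (v , 4‖v‖²≤1 , r≐p+v) , r-views-q) =
    q∈U , 1≤⟨⟩⇒views q∈U 1≤‖2p‖² (subst (1# ≤_) (sym (⟨·⟩ˡ 2# p q)) 1≤2a)
    where
    a = ⟨ p , q ⟩
    b = ⟨ v , q ⟩
    1≤a+b : 1# ≤ a + b
    1≤a+b = subst (1# ≤_) (trans (⟨⟩-congˡ r≐p+v q) (⟨+ᵥ⟩ˡ p v q)) (views⇒1≤⟨⟩ q∈U r-views-q)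
    1≤2a : 1# ≤ 2# * a
    1≤2a = 0≤y-x⇒x≤y (subst (0# ≤_)
      (solve 2 (λ a b → (a :+ b :- con 1ℤ) :+ (a :+ b :- con 1ℤ) :+ (con 1ℤ :- con (ℤ.+ 2) :* b)
                       := con (ℤ.+ 2) :* a :- con 1ℤ) refl a b)
      (+-nonneg (+-nonneg (x≤y⇒0≤y-x 1≤a+b) (x≤y⇒0≤y-x 1≤a+b))
                (x≤y⇒0≤y-x (‖v‖≤½⇒2⟨v,q⟩≤1 v q 4‖v‖²≤1 q∈U))))
    1≤‖2p‖² : 1# ≤ ‖ 2# · p ‖²
    1≤‖2p‖² = ≤-trans 1≤‖p‖² (subst (‖ p ‖² ≤_) 4N≡‖2p‖² (x≤x+y (+-nonneg 0≤N (+-nonneg 0≤N 0≤N))))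
      where
      N = ‖ p ‖²
      0≤N = ‖‖²-nonneg p
      4N≡‖2p‖² : N + (N + (N + N)) ≡ ‖ 2# · p ‖²
      4N≡‖2p‖² = sym (trans (‖·‖² 2# p)
        (solve 1 (λ N → con (ℤ.+ 2) :* (con (ℤ.+ 2) :* N) := N :+ (N :+ (N :+ N))) refl N))

lemma3 : {c : Level} (R : RealField c) → let open Geometry R in
         (d : ℕ) → 1 ≤ℕ d → (p : Pt d) → 1# ≤ ‖ p ‖² →
         (q : Pt d) → InQ₁ p q → InQ₂ p q
lemma3 R d _ = Q₁⊆Q₂ R
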